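{- For all integers $k\geq 2$ and $r\geq 1$, no graph $T\in\mathscr{T}_k$ (a $(2k+1)$-tetrahedron) admits a graph homomorphism to the Andrásfai graph $A_{k,r}$.
   Context: For $k\geq 2$, $\mathscr{T}_k$ is the set of graphs $T$ consisting of: a cycle $C_T$ with three distinct branch vertices $a_T,b_T,c_T\in V(C_T)$; a center vertex $z_T$ not on $C_T$; and three paths (spokes) $P_{az},P_{bz},P_{cz}$ connecting $a_T,b_T,c_T$ respectively with $z_T$, internally vertex disjoint (from each other and from $C_T$); moreover each spoke has length at least $2$, and every cycle in $T$ that contains $z_T$ and exactly two of the branch vertices has length $2k+1$. The Andrásfai graph $A_{k,r}$: let $n=(2k-1)(r-1)+2$; its vertex set is $\{i/n\colon i=0,\dots,n-1\}\subseteq\mathbb{R}/\mathbb{Z}$ and $u,v$ are adjacent iff $v-u\in\big(\tfrac{k-1}{2k-1},\tfrac{k}{2k-1}\big)$ modulo $1$. -}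

module Defs where

open import Data.Nat using (ℕ; zero; suc; _+_; _*_; _∸_; _≤_; _<_)
open import Data.Nat.DivMod using (_%_)
open import Data.Fin using (Fin; toℕ)
open import Data.Sum using (_⊎_)
open import Data.Product using (Σ; _×_)
open import Relation.Binary.PropositionalEquality using (_≡_)

-- A graph T ∈ 𝒯_k is determined up to isomorphism by:
--   * the lengths p, q, t ≥ 1 of the three arcs of the cycle C_T
--     between a_T–b_T, b_T–c_T, c_T–a_T (≥ 1 since the branch
--     vertices are distinct);
--   * the lengths sa, sb, sc ≥ 2 of the spokes P_az, P_bz, P_cz.
-- The cycles through z_T containing exactly two branch vertices are
-- exactly  P_az ∪ arc(a,b) ∪ P_bz  etc., so the length condition is
--   sa + p + sb = sb + q + sc = sc + t + sa = 2k+1.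

record TetData (k : ℕ) : Set where
  field
    p q t sa sb sc : ℕ
    p≥1 : 1 ≤ p
    q≥1 : 1 ≤ q
    t≥1 : 1 ≤ t
    sa≥2 : 2 ≤ sa
    sb≥2 : 2 ≤ sb
    sc≥2 : 2 ≤ sc
    cyc-ab : sa + p + sb ≡ 2 * k + 1
    cyc-bc : sb + q + sc ≡ 2 * k + 1
    cyc-ca : sc + t + sa ≡ 2 * k + 1

data Branch : Set where
  A B C : Branch

module Tet {k : ℕ} (T : TetData k) where
  open TetData T

  -- length of the cycle C_T; its vertices are Fin L, in cyclic order
  L : ℕ
  L = p + q + t

  pos : Branch → ℕ
  pos A = 0
  pos B = p
  pos C = p + q

  len : Branch → ℕ
  len A = sa
  len B = sb
  len C = sc

  -- vertices: the cycle, the center z_T, and the (len x - 1) internal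
  -- vertices of each spoke, indexed 0,1,... starting next to the
  -- branch vertex.
  data Vtx : Set where
    cyc : Fin L → Vtx
    ctr : Vtx
    sp  : (x : Branch) → Fin (len x ∸ 1) → Vtx

  data Arc : Vtx → Vtx → Set where
    cyc-step : ∀ {i j} → toℕ j ≡ suc (toℕ i) → Arc (cyc i) (cyc j)
    cyc-wrap : ∀ {i j} → suc (toℕ i) ≡ L → toℕ j ≡ 0 → Arc (cyc i) (cyc j)
    sp-start : ∀ {x i m} → toℕ i ≡ pos x → toℕ m ≡ 0 → Arc (cyc i) (sp x m)
    sp-step  : ∀ {x m m'} → toℕ m' ≡ suc (toℕ m) → Arc (sp x m) (sp x m')
    sp-end   : ∀ {x m} → suc (toℕ m) ≡ len x ∸ 1 → Arc (sp x m) ctr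

  Adj : Vtx → Vtx → Set
  Adj u v = Arc u v ⊎ Arc v u

andrasfaiN : ℕ → ℕ → ℕ
andrasfaiN k r = 2 + (2 * k ∸ 1) * (r ∸ 1)

-- vertex i ↔ i/n ∈ ℝ/ℤ.  For u = i/n, v = j/n, let d = (j - i) mod n, so
-- v - u ≡ d/n (mod 1) with 0 ≤ d/n < 1.  Then
--   d/n ∈ ((k-1)/(2k-1), k/(2k-1))  ⇔  (k-1)·n < d·(2k-1) < k·n.
AndrasfaiAdj : (k r : ℕ) → Fin (andrasfaiN k r) → Fin (andrasfaiN k r) → Set
AndrasfaiAdj k r i j =
  ((k ∸ 1) * n < d * (2 * k ∸ 1)) × (d * (2 * k ∸ 1) < k * n)
  where
    n = andrasfaiN k r
    d = (toℕ j + n ∸ toℕ i) % n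

HomToAndrasfai : (k r : ℕ) (T : TetData k) → Set
HomToAndrasfai k r T =
  Σ (Tet.Vtx T → Fin (andrasfaiN k r)) λ f →
    ∀ u v → Tet.Adj T u v → AndrasfaiAdj k r (f u) (f v)

module Submission where

-- Place vertex i of A_{k,r} at i/n on the circle ℝ/ℤ, where n = (2k−1)r′ + 2 and
-- r′ = r − 1. Every edge advances by d/n with |2d − n| ≤ r′, so a closed walk of
-- length m satisfies mn + s ≡ 0 (mod 2n) for its slack s, the sum of the 2d − n,
-- which has |s| ≤ m r′. The cycle a → b → c → z → a and its two rotations have
-- even length 2ℓ with ℓ ≤ 2k − 1, so |s| < 2n forces s = 0. Adding these three
-- relations, the spokes cancel and the arcs of C_T appear twice, so C_T has slack
-- 0 and hence even length. But its length 3(2k+1) − 2(|P_az| + |P_bz| + |P_cz|)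
-- is odd.

open import Defs
open import Data.Nat using (ℕ; zero; suc; _≤_)
open import Data.Integer using (ℤ; ∣_∣)
open import Data.Fin using (Fin; toℕ; fromℕ<)
open import Data.Fin.Properties using (toℕ-fromℕ<; toℕ-injective; toℕ<n)
open import Data.List using (_∷_; [])
open import Data.Product using (_×_; _,_; proj₁; proj₂)
open import Data.Sum using (inj₁; inj₂)
open import Relation.Nullary using (¬_)
open import Relation.Binary.PropositionalEquality
  using (_≡_; _≢_; refl; sym; trans; cong; cong₂; subst; subst₂; module ≡-Reasoning)

module _ where
  open import Data.Nat
  open import Data.Nat.Properties
  open import Data.Nat.Tactic.RingSolver using (solve)

  andrasfai-distance-bounds : ∀ {k′ r′ d} →
    let n = andrasfaiN (suc k′) (suc r′) ; K = 2 * suc k′ ∸ 1 in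
    k′ * n < d * K → d * K < suc k′ * n → n ≤ 2 * d + r′ × 2 * d ≤ n + r′
  andrasfai-distance-bounds {k′} {r′} {d} = bounds _ (cong (_∸ 1) (*-suc 2 k′))
    where
    bounds : ∀ K → K ≡ suc (2 * k′) → let n = 2 + K * r′ in
      k′ * n < d * K → d * K < suc k′ * n → n ≤ 2 * d + r′ × 2 * d ≤ n + r′
    -- Doubling the strict inequalities gains exactly the 2 in n = 2 + K r′.
    bounds _ refl lo hi =
      *-cancelˡ-≤ (suc (2 * k′)) lower , *-cancelˡ-≤ (suc (2 * k′)) (+-cancelʳ-≤ 2 _ _ upper)
      where
      open ≤-Reasoning
      lower : suc (2 * k′) * (2 + suc (2 * k′) * r′) ≤ suc (2 * k′) * (2 * d + r′)
      lower = begin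
        suc (2 * k′) * (2 + suc (2 * k′) * r′)
          ≡⟨ solve (k′ ∷ r′ ∷ []) ⟩
        2 * suc (k′ * (2 + suc (2 * k′) * r′)) + suc (2 * k′) * r′
          ≤⟨ +-monoˡ-≤ _ (*-monoʳ-≤ 2 lo) ⟩
        2 * (d * suc (2 * k′)) + suc (2 * k′) * r′
          ≡⟨ solve (k′ ∷ r′ ∷ d ∷ []) ⟩
        suc (2 * k′) * (2 * d + r′) ∎
      upper : suc (2 * k′) * (2 * d) + 2 ≤ suc (2 * k′) * (2 + suc (2 * k′) * r′ + r′) + 2
      upper = begin
        suc (2 * k′) * (2 * d) + 2
          ≡⟨ solve (k′ ∷ d ∷ []) ⟩
        2 * suc (d * suc (2 * k′))
          ≤⟨ *-monoʳ-≤ 2 hi ⟩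
        2 * (suc k′ * (2 + suc (2 * k′) * r′))
          ≡⟨ solve (k′ ∷ r′ ∷ []) ⟩
        suc (2 * k′) * (2 + suc (2 * k′) * r′ + r′) + 2 ∎

module _ where
  open import Data.Nat as ℕ using (ℕ)
  import Data.Nat.Properties as ℕ
  open import Data.Integer
  open import Data.Integer.Properties

  ∣+m-+n∣≤o : ∀ {m n o} → m ℕ.≤ n ℕ.+ o → n ℕ.≤ m ℕ.+ o → ∣ + m - + n ∣ ℕ.≤ o
  ∣+m-+n∣≤o {m} {n} m≤n+o n≤m+o rewrite m-n≡m⊖n m n with ℕ.≤-total m n
  ... | inj₁ m≤n rewrite ∣⊖∣-≤ m≤n = ℕ.m≤n+o⇒m∸n≤o n m n≤m+o
  ... | inj₂ n≤m rewrite ⊖-≥ n≤m   = ℕ.m≤n+o⇒m∸n≤o m n m≤n+o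

  ∣i*j∣<∣i∣⇒j≡0 : ∀ i j → ∣ i * j ∣ ℕ.< ∣ i ∣ → j ≡ 0ℤ
  ∣i*j∣<∣i∣⇒j≡0 i j lt = ∣i∣≡0⇒i≡0 (ℕ.n<1⇒n≡0 (ℕ.*-cancelˡ-< ∣ i ∣ ∣ j ∣ 1
    (subst₂ ℕ._<_ (∣i*j∣≡∣i∣*∣j∣ i j) (sym (ℕ.*-identityʳ ∣ i ∣)) lt)))

-- A walk of length m from position x to position y of A_{k,r} satisfies
-- 2x + mn + s = 2y + 2nw, where its slack s is the sum of 2d − n over its steps
-- (each advancing by d positions) and w counts its turns around the circle.
module _ (n : ℤ) where
  open import Data.Integer
  open import Data.Integer.Properties
  open import Data.Integer.Tactic.RingSolver using (solve)
  open ≡-Reasoning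

  balance-refl : ∀ x → + 2 * x + 0ℤ * n + 0ℤ ≡ + 2 * x + + 2 * n * 0ℤ
  balance-refl x = solve (x ∷ n ∷ [])

  balance-step : ∀ {x y d q} → x + (d + q * n) ≡ y + n →
                 + 2 * x + + 1 * n + (+ 2 * d - n) ≡ + 2 * y + + 2 * n * (+ 1 - q)
  balance-step {x} {y} {d} {q} turn = begin
    + 2 * x + + 1 * n + (+ 2 * d - n)     ≡⟨ solve (x ∷ n ∷ d ∷ q ∷ []) ⟩
    + 2 * (x + (d + q * n)) - + 2 * q * n ≡⟨ cong (λ z → + 2 * z - + 2 * q * n) turn ⟩
    + 2 * (y + n) - + 2 * q * n           ≡⟨ solve (y ∷ n ∷ q ∷ []) ⟩
    + 2 * y + + 2 * n * (+ 1 - q)         ∎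

  balance-trans : ∀ {x y z m₁ m₂ s₁ s₂ w₁ w₂} →
    + 2 * x + m₁ * n + s₁ ≡ + 2 * y + + 2 * n * w₁ →
    + 2 * y + m₂ * n + s₂ ≡ + 2 * z + + 2 * n * w₂ →
    + 2 * x + (m₁ + m₂) * n + (s₁ + s₂) ≡ + 2 * z + + 2 * n * (w₁ + w₂)
  balance-trans {x} {y} {z} {m₁} {m₂} {s₁} {s₂} {w₁} {w₂} xy yz = begin
    + 2 * x + (m₁ + m₂) * n + (s₁ + s₂)      ≡⟨ solve (x ∷ m₁ ∷ m₂ ∷ n ∷ s₁ ∷ s₂ ∷ []) ⟩
    (+ 2 * x + m₁ * n + s₁) + (m₂ * n + s₂)  ≡⟨ cong (_+ (m₂ * n + s₂)) xy ⟩
    (+ 2 * y + + 2 * n * w₁) + (m₂ * n + s₂) ≡⟨ solve (y ∷ n ∷ w₁ ∷ m₂ ∷ s₂ ∷ []) ⟩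
    (+ 2 * y + m₂ * n + s₂) + + 2 * n * w₁   ≡⟨ cong (_+ + 2 * n * w₁) yz ⟩
    (+ 2 * z + + 2 * n * w₂) + + 2 * n * w₁  ≡⟨ solve (z ∷ n ∷ w₁ ∷ w₂ ∷ []) ⟩
    + 2 * z + + 2 * n * (w₁ + w₂)            ∎

  balance-sym : ∀ {x y m s w} →
    + 2 * x + m * n + s ≡ + 2 * y + + 2 * n * w →
    + 2 * y + m * n + - s ≡ + 2 * x + + 2 * n * (m - w)
  balance-sym {x} {y} {m} {s} {w} xy = begin
    + 2 * y + m * n + - s
      ≡⟨ solve (x ∷ y ∷ m ∷ n ∷ s ∷ w ∷ []) ⟩
    (+ 2 * y + + 2 * n * w) - (+ 2 * x + m * n + s) + (+ 2 * x + + 2 * n * (m - w))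
      ≡⟨ cong (λ z → z - (+ 2 * x + m * n + s) + (+ 2 * x + + 2 * n * (m - w))) (sym xy) ⟩
    (+ 2 * x + m * n + s) - (+ 2 * x + m * n + s) + (+ 2 * x + + 2 * n * (m - w))
      ≡⟨ solve (x ∷ m ∷ n ∷ s ∷ w ∷ []) ⟩
    + 2 * x + + 2 * n * (m - w)
      ∎

  balance-closed : ∀ {x m s w} → + 2 * x + m * n + s ≡ + 2 * x + + 2 * n * w → m * n + s ≡ + 2 * n * w
  balance-closed {x} {m} {s} {w} xx = begin
    m * n + s                          ≡⟨ solve (x ∷ m ∷ n ∷ s ∷ []) ⟩
    (+ 2 * x + m * n + s) - + 2 * x    ≡⟨ cong (_- + 2 * x) xx ⟩
    (+ 2 * x + + 2 * n * w) - + 2 * x  ≡⟨ solve (x ∷ n ∷ w ∷ []) ⟩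
    + 2 * n * w                        ∎

  even-closed-slack : ∀ {j s w} → + 2 * j * n + s ≡ + 2 * n * w → s ≡ + 2 * n * (w - j)
  even-closed-slack {j} {s} {w} closed = begin
    s                                ≡⟨ solve (j ∷ n ∷ s ∷ []) ⟩
    (+ 2 * j * n + s) - + 2 * j * n  ≡⟨ cong (_- + 2 * j * n) closed ⟩
    + 2 * n * w - + 2 * j * n        ≡⟨ solve (n ∷ w ∷ j ∷ []) ⟩
    + 2 * n * (w - j)                ∎

  zero-slack-closed : .{{_ : NonZero n}} → ∀ {m w} → m * n + 0ℤ ≡ + 2 * n * w → m ≡ + 2 * w
  zero-slack-closed {m} {w} closed = *-cancelʳ-≡ m (+ 2 * w) n (begin
    m * n          ≡⟨ sym (+-identityʳ (m * n)) ⟩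
    m * n + 0ℤ     ≡⟨ closed ⟩
    + 2 * n * w    ≡⟨ solve (n ∷ w ∷ []) ⟩
    + 2 * w * n    ∎)

module _ where
  open import Data.Nat
  open import Data.Nat.Properties
  open import Data.Nat.Tactic.RingSolver using (solve)

  cycle-length-odd : ∀ {k} (T : TetData k) e → Tet.L T ≢ 2 * e
  cycle-length-odd {k} record { p = p ; q = q ; t = t ; sa = sa ; sb = sb ; sc = sc
                              ; cyc-ab = ab ; cyc-bc = bc ; cyc-ca = ca } e L≡2e =
    even≢odd (sa + sb + sc + e) (3 * k + 1) (begin
      2 * (sa + sb + sc + e)                         ≡⟨ solve (sa ∷ sb ∷ sc ∷ e ∷ []) ⟩
      2 * (sa + sb + sc) + 2 * e                     ≡⟨ cong (2 * (sa + sb + sc) +_) L≡2e ⟨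
      2 * (sa + sb + sc) + (p + q + t)               ≡⟨ solve (sa ∷ sb ∷ sc ∷ p ∷ q ∷ t ∷ []) ⟩
      (sa + p + sb) + (sb + q + sc) + (sc + t + sa)  ≡⟨ cong₂ _+_ (cong₂ _+_ ab bc) ca ⟩
      (2 * k + 1) + (2 * k + 1) + (2 * k + 1)        ≡⟨ solve (k ∷ []) ⟩
      suc (2 * (3 * k + 1))                          ∎)
    where open ≡-Reasoning

  theta-length : ∀ s₁ a₁ s₂ a₂ s₃ {M} → s₁ + a₁ + s₂ ≡ M → s₂ + a₂ + s₃ ≡ M →
                 a₁ + a₂ + s₃ + s₁ ≡ 2 * (s₁ + a₁)
  theta-length s₁ a₁ s₂ a₂ s₃ e₁ e₂ = +-cancelʳ-≡ s₂ _ _ (begin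
    a₁ + a₂ + s₃ + s₁ + s₂         ≡⟨ solve (a₁ ∷ a₂ ∷ s₃ ∷ s₁ ∷ s₂ ∷ []) ⟩
    (s₂ + a₂ + s₃) + (s₁ + a₁)     ≡⟨ cong (_+ (s₁ + a₁)) (trans e₂ (sym e₁)) ⟩
    (s₁ + a₁ + s₂) + (s₁ + a₁)     ≡⟨ solve (s₁ ∷ a₁ ∷ s₂ ∷ []) ⟩
    2 * (s₁ + a₁) + s₂             ∎)
    where open ≡-Reasoning

  theta-half-bound : ∀ k r′ s₁ a₁ s₂ → s₁ + a₁ + s₂ ≡ 2 * k + 1 → 2 ≤ s₂ →
                     (s₁ + a₁) * r′ < andrasfaiN k (suc r′)
  theta-half-bound k r′ s₁ a₁ s₂ e s₂≥2 = begin-strict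
    (s₁ + a₁) * r′          ≤⟨ *-monoˡ-≤ r′ (m+n≤o⇒m≤o∸n (s₁ + a₁) (+-cancelʳ-≤ 1 _ _ half+2≤)) ⟩
    (2 * k ∸ 1) * r′        <⟨ m<n+m _ z<s ⟩
    2 + (2 * k ∸ 1) * r′    ∎
    where
    open ≤-Reasoning
    half+2≤ : s₁ + a₁ + 1 + 1 ≤ 2 * k + 1
    half+2≤ = begin
      s₁ + a₁ + 1 + 1   ≡⟨ +-assoc (s₁ + a₁) 1 1 ⟩
      s₁ + a₁ + 2       ≤⟨ +-monoʳ-≤ (s₁ + a₁) s₂≥2 ⟩
      s₁ + a₁ + s₂      ≡⟨ e ⟩
      2 * k + 1         ∎

module _ where
  open import Data.Integer
  open import Data.Integer.Properties
  open import Data.Integer.Tactic.RingSolver using (solve)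

  theta-slacks-cancel : ∀ x y z α β γ →
    x + y + γ - α ≡ 0ℤ → y + z + α - β ≡ 0ℤ → z + x + β - γ ≡ 0ℤ → x + y + z ≡ 0ℤ
  theta-slacks-cancel x y z α β γ h₁ h₂ h₃ = *-cancelˡ-≡ (+ 2) _ _ (begin
    + 2 * (x + y + z)                                    ≡⟨ solve (x ∷ y ∷ z ∷ α ∷ β ∷ γ ∷ []) ⟩
    (x + y + γ - α) + (y + z + α - β) + (z + x + β - γ)  ≡⟨ cong₂ _+_ (cong₂ _+_ h₁ h₂) h₃ ⟩
    + 2 * 0ℤ                                             ∎)
    where open ≡-Reasoning

infixr 5 _∷_

data Walk {V : Set} (E : V → V → Set) : V → V → ℕ → Set where
  []  : ∀ {u} → Walk E u u 0
  _∷_ : ∀ {u v w m} → E u v → Walk E v w m → Walk E u w (suc m)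

module _ {V : Set} {E : V → V → Set} where
  open import Data.Nat
  open import Data.Nat.Properties

  infixr 5 _++_

  _++_ : ∀ {u v w m₁ m₂} → Walk E u v m₁ → Walk E v w m₂ → Walk E u w (m₁ + m₂)
  []      ++ w₂ = w₂
  (e ∷ w₁) ++ w₂ = e ∷ (w₁ ++ w₂)

  [_] : ∀ {u v} → E u v → Walk E u v 1
  [ e ] = e ∷ []

  path-walk : ∀ {ℓ} (g : Fin ℓ → V) → (∀ {i j} → toℕ j ≡ suc (toℕ i) → E (g i) (g j)) →
              ∀ m (i j : Fin ℓ) → m + toℕ i ≡ toℕ j → Walk E (g i) (g j) m
  path-walk g next zero    i j eq = subst (λ j → Walk E (g i) (g j) 0) (toℕ-injective eq) []
  path-walk {ℓ} g next (suc m) i j eq =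
    next {i} {i′} (toℕ-fromℕ< i+1<ℓ) ∷ path-walk g next m i′ j (begin
      m + toℕ i′       ≡⟨ cong (m +_) (toℕ-fromℕ< i+1<ℓ) ⟩
      m + suc (toℕ i)  ≡⟨ +-suc m (toℕ i) ⟩
      suc m + toℕ i    ≡⟨ eq ⟩
      toℕ j            ∎)
    where
    open ≡-Reasoning
    i+1<ℓ : suc (toℕ i) < ℓ
    i+1<ℓ = ≤-<-trans (s≤s (m≤n+m (toℕ i) m)) (subst (_< ℓ) (sym eq) (toℕ<n j))
    i′ : Fin ℓ
    i′ = fromℕ< i+1<ℓ

module Winding {V : Set} (E : V → V → Set) {k′ r′ : ℕ}
  (f : V → Fin (andrasfaiN (suc k′) (suc r′)))
  (hom : ∀ u v → E u v → AndrasfaiAdj (suc k′) (suc r′) (f u) (f v)) where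
  import Data.Nat as ℕ
  import Data.Nat.Properties as ℕ
  open import Data.Nat.DivMod using (m≡m%n+[m/n]*n)
  open import Data.Integer hiding (suc)
  open import Data.Integer.Properties using (∣i+j∣≤∣i∣+∣j∣; ∣-i∣≡∣i∣; ∣i*j∣≡∣i∣*∣j∣; pos-*; *-zeroʳ)

  n : ℕ
  n = andrasfaiN (suc k′) (suc r′)

  position : V → ℤ
  position u = + toℕ (f u)

  record Displacement (u v : V) (m : ℕ) : Set where
    field
      slack winding : ℤ
      slack-bound : ∣ slack ∣ ℕ.≤ m ℕ.* r′
      balance : + 2 * position u + + m * + n + slack ≡ + 2 * position v + + 2 * + n * winding
  open Displacement public

  private variable
    u v w : V
    m m₁ m₂ ℓ : ℕ

  stay : Displacement u u 0
  stay {u} = record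
    { slack = 0ℤ ; winding = 0ℤ ; slack-bound = ℕ.z≤n ; balance = balance-refl (+ n) (position u) }

  infixl 5 _⨾_

  _⨾_ : Displacement u v m₁ → Displacement v w m₂ → Displacement u w (m₁ ℕ.+ m₂)
  _⨾_ {u = u} {v = v} {m₁ = m₁} {w = w} {m₂ = m₂} d₁ d₂ = record
    { slack       = slack d₁ + slack d₂
    ; winding     = winding d₁ + winding d₂
    ; slack-bound = ℕ.≤-trans (∣i+j∣≤∣i∣+∣j∣ (slack d₁) (slack d₂)) (ℕ.≤-trans
        (ℕ.+-mono-≤ (slack-bound d₁) (slack-bound d₂)) (ℕ.≤-reflexive (sym (ℕ.*-distribʳ-+ r′ m₁ m₂))))
    ; balance     = balance-trans (+ n) {position u} {position v} {position w} {+ m₁} {+ m₂}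
                      {w₁ = winding d₁} {winding d₂} (balance d₁) (balance d₂)
    }

  reverse : Displacement u v m → Displacement v u m
  reverse {u = u} {v = v} {m = m} d = record
    { slack       = - slack d
    ; winding     = + m - winding d
    ; slack-bound = subst (ℕ._≤ m ℕ.* r′) (sym (∣-i∣≡∣i∣ (slack d))) (slack-bound d)
    ; balance     = balance-sym (+ n) {position u} {position v} {+ m} {w = winding d} (balance d)
    }

  step : E u v → Displacement u v 1
  step {u} {v} e = record
    { slack       = + 2 * + d - + n
    ; winding     = + 1 - + q
    ; slack-bound = subst₂ (λ s b → ∣ s - + n ∣ ℕ.≤ b) (pos-* 2 d) (sym (ℕ.*-identityˡ r′))
                      (∣+m-+n∣≤o (proj₂ bounds) (proj₁ bounds))
    ; balance     = balance-step (+ n) {+ i} {+ j} {+ d} {+ q}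
                      (trans (cong (λ z → + i + (+ d + z)) (sym (pos-* q n))) (cong +_ turn))
    }
    where
    i j : ℕ
    i = toℕ (f u)
    j = toℕ (f v)
    d q : ℕ
    d = (j ℕ.+ n ℕ.∸ i) ℕ.% n
    q = (j ℕ.+ n ℕ.∸ i) ℕ./ n
    bounds : n ℕ.≤ 2 ℕ.* d ℕ.+ r′ × 2 ℕ.* d ℕ.≤ n ℕ.+ r′
    bounds = andrasfai-distance-bounds {k′} {r′} {d} (proj₁ (hom u v e)) (proj₂ (hom u v e))
    turn : i ℕ.+ (d ℕ.+ q ℕ.* n) ≡ j ℕ.+ n
    turn = trans (cong (i ℕ.+_) (sym (m≡m%n+[m/n]*n (j ℕ.+ n ℕ.∸ i) n)))
                 (ℕ.m+[n∸m]≡n (ℕ.≤-trans (ℕ.<⇒≤ (toℕ<n (f u))) (ℕ.m≤n+m n j)))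

  walk-displacement : Walk E u v m → Displacement u v m
  walk-displacement []       = stay
  walk-displacement (e ∷ es) = step e ⨾ walk-displacement es

  closed-balance : (d : Displacement u u m) → + m * + n + slack d ≡ + 2 * + n * winding d
  closed-balance {u = u} {m = m} d = balance-closed (+ n) {position u} {+ m} {w = winding d} (balance d)

  even-closed-walk-slack : (d : Displacement u u m) → m ≡ 2 ℕ.* ℓ → ℓ ℕ.* r′ ℕ.< n → slack d ≡ 0ℤ
  even-closed-walk-slack {m = m} {ℓ = ℓ} d m≡2ℓ short =
    trans slack≡ (trans (cong (+ 2 * + n *_) turns≡0) (*-zeroʳ (+ 2 * + n)))
    where
    slack≡ : slack d ≡ + 2 * + n * (winding d - + ℓ)
    slack≡ = even-closed-slack (+ n) {+ ℓ} {w = winding d}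
      (subst (λ a → a * + n + slack d ≡ _) (trans (cong +_ m≡2ℓ) (pos-* 2 ℓ)) (closed-balance d))
    small : ∣ slack d ∣ ℕ.< 2 ℕ.* n
    small = ℕ.≤-<-trans (slack-bound d) (begin-strict
      m ℕ.* r′          ≡⟨ cong (ℕ._* r′) m≡2ℓ ⟩
      2 ℕ.* ℓ ℕ.* r′    ≡⟨ ℕ.*-assoc 2 ℓ r′ ⟩
      2 ℕ.* (ℓ ℕ.* r′)  <⟨ ℕ.*-monoʳ-< 2 short ⟩
      2 ℕ.* n           ∎)
      where open ℕ.≤-Reasoning
    turns≡0 : winding d - + ℓ ≡ 0ℤ
    turns≡0 = ∣i*j∣<∣i∣⇒j≡0 (+ 2 * + n) _
      (subst₂ ℕ._<_ (cong ∣_∣ slack≡) (cong ∣_∣ (pos-* 2 n)) small)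

  zero-slack⇒even-length : (d : Displacement u u m) → slack d ≡ 0ℤ → m ≡ 2 ℕ.* ∣ winding d ∣
  zero-slack⇒even-length {m = m} d slack≡0 = begin
    ∣ + m ∣                ≡⟨ cong ∣_∣ (zero-slack-closed (+ n) {+ m} {winding d} closed) ⟩
    ∣ + 2 * winding d ∣    ≡⟨ ∣i*j∣≡∣i∣*∣j∣ (+ 2) (winding d) ⟩
    2 ℕ.* ∣ winding d ∣    ∎
    where
    open ≡-Reasoning
    closed : + m * + n + 0ℤ ≡ + 2 * + n * winding d
    closed = subst (λ s → + m * + n + s ≡ _) slack≡0 (closed-balance d)

module TetrahedronWalks {k : ℕ} (T : TetData k) where
  open import Data.Nat
  open import Data.Nat.Properties
  open TetData T
  open Tet T

  pos<L : ∀ x → pos x < L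
  pos<L A = <-≤-trans p≥1 (≤-trans (m≤m+n p q) (m≤m+n (p + q) t))
  pos<L B = <-≤-trans (m<m+n p q≥1) (m≤m+n (p + q) t)
  pos<L C = m<m+n (p + q) t≥1

  corner : Branch → Fin L
  corner x = fromℕ< (pos<L x)

  len≥2 : ∀ x → 2 ≤ len x
  len≥2 A = sa≥2
  len≥2 B = sb≥2
  len≥2 C = sc≥2

  cycle-path : ∀ m {i j} .(i<L : i < L) .(j<L : j < L) → m + i ≡ j →
               Walk Adj (cyc (fromℕ< i<L)) (cyc (fromℕ< j<L)) m
  cycle-path m i<L j<L m+i≡j = path-walk cyc (λ e → inj₁ (cyc-step e)) m _ _
    (trans (cong (m +_) (toℕ-fromℕ< i<L)) (trans m+i≡j (sym (toℕ-fromℕ< j<L))))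

  arc-AB : Walk Adj (cyc (corner A)) (cyc (corner B)) p
  arc-AB = cycle-path p (pos<L A) (pos<L B) (+-identityʳ p)

  arc-BC : Walk Adj (cyc (corner B)) (cyc (corner C)) q
  arc-BC = cycle-path q (pos<L B) (pos<L C) (+-comm q p)

  arc-CA : Walk Adj (cyc (corner C)) (cyc (corner A)) t
  arc-CA = subst (Walk Adj _ _) (m∸n+n≡m t≥1)
    (cycle-path (t ∸ 1) (pos<L C) last<L (+-comm (t ∸ 1) (p + q))
      ++ [ inj₁ (cyc-wrap {fromℕ< last<L} {corner A} (trans (cong suc (toℕ-fromℕ< last<L)) last+1≡L)
                                                  (toℕ-fromℕ< (pos<L A))) ])
    where
    last+1≡L : suc (p + q + (t ∸ 1)) ≡ L
    last+1≡L = trans (sym (+-suc (p + q) (t ∸ 1))) (cong (p + q +_) (m+[n∸m]≡n t≥1))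
    last<L : p + q + (t ∸ 1) < L
    last<L = ≤-reflexive last+1≡L

  spoke : ∀ x → Walk Adj (cyc (corner x)) ctr (len x)
  spoke x = subst (Walk Adj _ ctr) (trans (cong suc (m∸n+n≡m 1≤ℓ)) (m+[n∸m]≡n len≥1))
    (inj₁ (sp-start (toℕ-fromℕ< (pos<L x)) (toℕ-fromℕ< 0<ℓ))
      ∷ path-walk (sp x) (λ e → inj₁ (sp-step e)) (ℓ ∸ 1) first last
          (trans (cong (ℓ ∸ 1 +_) (toℕ-fromℕ< 0<ℓ))
                 (trans (+-identityʳ (ℓ ∸ 1)) (sym (toℕ-fromℕ< last<ℓ))))
      ++ [ inj₁ (sp-end {x} {last} (trans (cong suc (toℕ-fromℕ< last<ℓ)) (m+[n∸m]≡n 1≤ℓ))) ])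
    where
    ℓ : ℕ
    ℓ = len x ∸ 1
    len≥1 : 1 ≤ len x
    len≥1 = ≤-trans (s≤s z≤n) (len≥2 x)
    1≤ℓ : 1 ≤ ℓ
    1≤ℓ = ∸-monoˡ-≤ 1 (len≥2 x)
    0<ℓ : 0 < ℓ
    0<ℓ = 1≤ℓ
    last<ℓ : ℓ ∸ 1 < ℓ
    last<ℓ = ≤-reflexive (m+[n∸m]≡n 1≤ℓ)
    first last : Fin ℓ
    first = fromℕ< 0<ℓ
    last = fromℕ< last<ℓ

module TetrahedronInAndrasfai {k′ r′ : ℕ} (T : TetData (suc k′))
  (f : Tet.Vtx T → Fin (andrasfaiN (suc k′) (suc r′)))
  (hom : ∀ u v → Tet.Adj T u v → AndrasfaiAdj (suc k′) (suc r′) (f u) (f v)) where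
  open import Data.Nat using (_+_; _*_)
  open import Data.Integer using (0ℤ)
  open TetData T
  open Tet T using (L; len; cyc; ctr; Adj)
  open TetrahedronWalks T
  open Winding Adj {k′} {r′} f hom

  spoke-displacement : ∀ x → Displacement (cyc (corner x)) ctr (len x)
  spoke-displacement x = walk-displacement (spoke x)

  ab : Displacement (cyc (corner A)) (cyc (corner B)) p
  ab = walk-displacement arc-AB

  bc : Displacement (cyc (corner B)) (cyc (corner C)) q
  bc = walk-displacement arc-BC

  ca : Displacement (cyc (corner C)) (cyc (corner A)) t
  ca = walk-displacement arc-CA

  cycle : Displacement (cyc (corner A)) (cyc (corner A)) L
  cycle = ab ⨾ bc ⨾ ca

  -- d goes round the outer cycle of the theta graph formed by the two
  -- (2k+1)-cycles through z_T that share the spoke of length s₂.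
  theta-slack : ∀ {u} s₁ a₁ s₂ a₂ s₃ →
    s₁ + a₁ + s₂ ≡ 2 * suc k′ + 1 → s₂ + a₂ + s₃ ≡ 2 * suc k′ + 1 → 2 ≤ s₂ →
    (d : Displacement u u (a₁ + a₂ + s₃ + s₁)) → slack d ≡ 0ℤ
  theta-slack s₁ a₁ s₂ a₂ s₃ e₁ e₂ s₂≥2 d = even-closed-walk-slack {ℓ = s₁ + a₁} d
    (theta-length s₁ a₁ s₂ a₂ s₃ e₁ e₂) (theta-half-bound (suc k′) r′ s₁ a₁ s₂ e₁ s₂≥2)

  cycle-turns : ℕ
  cycle-turns = ∣ winding cycle ∣

  cycle-length-even : L ≡ 2 * cycle-turns
  cycle-length-even = zero-slack⇒even-length cycle
    (theta-slacks-cancel (slack ab) (slack bc) (slack ca) (slack a) (slack b) (slack c)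
      (theta-slack sa p sb q sc cyc-ab cyc-bc sb≥2 (ab ⨾ bc ⨾ c ⨾ reverse a))
      (theta-slack sb q sc t sa cyc-bc cyc-ca sc≥2 (bc ⨾ ca ⨾ a ⨾ reverse b))
      (theta-slack sc t sa p sb cyc-ca cyc-ab sa≥2 (ca ⨾ ab ⨾ b ⨾ reverse c)))
    where
    a : Displacement (cyc (corner A)) ctr sa
    a = spoke-displacement A
    b : Displacement (cyc (corner B)) ctr sb
    b = spoke-displacement B
    c : Displacement (cyc (corner C)) ctr sc
    c = spoke-displacement C

lemma5p2 : (k r : ℕ) → 2 ≤ k → 1 ≤ r → (T : TetData k) → ¬ HomToAndrasfai k r T
lemma5p2 zero     _        ()  _  _ _
lemma5p2 (suc k′) zero     _   () _ _
lemma5p2 (suc k′) (suc r′) _   _  T (f , hom) =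
  cycle-length-odd T cycle-turns cycle-length-even
  where open TetrahedronInAndrasfai {k′} {r′} T f hom
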